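{- Let $|z|<1$, $|q|<1$, and let $(b_k)_{k\ge1}$ be a sequence of complex numbers. Let $$Q(q)=\prod_{k=1}^\infty\frac{1}{(1-zq^k)^{b_k}}=\sum_{n\ge0}P(n)q^n,$$ so that $$P(n)=\sum_{\pi=\sum r_iu_i,\ |\pi|=n}\ \prod_i\frac{(b_i)_{r_i}}{r_i!}z^{r_i},$$ the sum over all partitions $\pi$ of $n$, and define $$F_k(n)=\sum_{\pi=\sum r_iu_i,\ |\pi|=n,\ r_k>0} r_k\prod_i\frac{(b_i)_{r_i}}{r_i!}z^{r_i},$$ the sum over all partitions of $n$ containing $k$ as a part. Then: (a) $P(0)=1$; (b) for every $n\ge1$ and every $i=1,\dots,n$, $$F_i(n)=\sum_{j=1}^n a_i(j)P(n-j),\qquad a_i(j)=\begin{cases}b_iz^r,& j=ri \text{ for some integer } r\ge1,\\ 0,&\text{otherwise};\end{cases}$$ equivalently $iF_i(n)=\sum_{j=1}^n i\,a_i(j)P(n-j)$; (c) for every $n\ge1$, $\sum_{k=1}^n kF_k(n)=nP(n)$.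
   Context: A partition $\pi$ of $n$ is written $\pi=\sum_i r_iu_i$, meaning the part $i$ occurs $r_i\ge0$ times, with $\sum_i ir_i=n$ (written $|\pi|=n$). $(a)_0=1$ and $(a)_r=a(a+1)\cdots(a+r-1)$ for $r>0$. -}

module Defs where

open import Level using (Level)
open import Data.Nat using (ℕ; zero; suc; _≟_)
import Data.Nat as N
open import Data.Nat.Base using (_!)
open import Data.Nat.Divisibility using (_∣?_; divides)
open import Data.Fin using (Fin; toℕ)
open import Data.Vec using (Vec; []; _∷_)
open import Data.List using (List; []; _∷_; map; concatMap; foldr; upTo; filter)
open import Relation.Nullary using (yes; no)
open import Relation.Nullary.Decidable using (does)
open import Data.Bool using (if_then_else_)
open import Algebra.Bundles using (CommutativeRing)

-- A partition of n is encoded by its multiplicity vector (r_1,…,r_n) : Vec ℕ n,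
-- where the head is r_1 (multiplicity of the part 1), the next r_2, etc.
-- (Parts larger than n cannot occur in a partition of n.)

weight′ : ∀ {m} → ℕ → Vec ℕ m → ℕ
weight′ s []       = 0
weight′ s (x ∷ xs) = suc s N.* x N.+ weight′ (suc s) xs

weight : ∀ {m} → Vec ℕ m → ℕ
weight = weight′ 0

-- multiplicity r_k of the part k (0 if k = 0 or k exceeds the length)
mult : ∀ {m} → Vec ℕ m → ℕ → ℕ
mult []       _             = 0
mult (x ∷ xs) zero          = 0
mult (x ∷ xs) (suc zero)    = x
mult (x ∷ xs) (suc (suc k)) = mult xs (suc k)

box : ℕ → (m : ℕ) → List (Vec ℕ m)
box B zero    = [] ∷ []
box B (suc m) = concatMap (λ x → map (x ∷_) (box B m)) (upTo (suc B))

-- all partitions of n, as multiplicity vectors (every multiplicity is ≤ n)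
partitions : (n : ℕ) → List (Vec ℕ n)
partitions n = filter (λ r → weight r ≟ n) (box n n)

natR : ∀ {c ℓ : Level} (R : CommutativeRing c ℓ) → ℕ → CommutativeRing.Carrier R
natR R zero    = CommutativeRing.0# R
natR R (suc n) = CommutativeRing._+_ R (CommutativeRing.1# R) (natR R n)

module Setup {c ℓ : Level} (R : CommutativeRing c ℓ)
             (inv : ℕ → CommutativeRing.Carrier R)
             (z : CommutativeRing.Carrier R)
             (b : ℕ → CommutativeRing.Carrier R) where
  open CommutativeRing R

  nat : ℕ → Carrier
  nat = natR R

  _·_ : ℕ → Carrier → Carrier
  n · x = nat n * x

  pow : Carrier → ℕ → Carrier
  pow x zero    = 1#
  pow x (suc n) = x * pow x n

  poch : Carrier → ℕ → Carrier
  poch a zero    = 1#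
  poch a (suc r) = poch a r * (a + nat r)

  sumL : List Carrier → Carrier
  sumL = foldr _+_ 0#

  sumFrom1 : ℕ → (ℕ → Carrier) → Carrier
  sumFrom1 zero    f = 0#
  sumFrom1 (suc n) f = sumFrom1 n f + f (suc n)

  -- Π_i (b_i)_{r_i} / r_i! · z^{r_i},  where 1/(r!) is  inv (r !)
  weightTerm′ : ∀ {m} → ℕ → Vec ℕ m → Carrier
  weightTerm′ s []       = 1#
  weightTerm′ s (r ∷ rs) =
    (poch (b (suc s)) r * inv (r !) * pow z r) * weightTerm′ (suc s) rs

  weightTerm : ∀ {m} → Vec ℕ m → Carrier
  weightTerm = weightTerm′ 0

  P : ℕ → Carrier
  P n = sumL (map weightTerm (partitions n))

  F : ℕ → ℕ → Carrier
  F k n = sumL (map (λ r → mult r k · weightTerm r)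
                    (filter (λ r → 1 N.≤? mult r k) (partitions n)))

  a : ℕ → ℕ → Carrier
  a i zero = 0#
  a i (suc j) with i ∣? suc j
  ... | yes (divides r _) = b i * pow z r
  ... | no _              = 0#

{-# OPTIONS --safe #-}
module Submission where

open import Defs
open import Level using (Level)
open import Data.Nat as ℕ using (ℕ; zero; suc; _≤_; _<_; _∸_; z≤n; s≤s; z<s; _≟_; _≤?_)
import Data.Nat.Properties as ℕₚ
open import Data.Nat.Divisibility using (_∣?_; divides)
open import Data.Product using (_×_; _,_)
open import Data.List using (List; []; _∷_; map; foldr; _++_; concat; applyUpTo; filter)
import Data.List.Properties as Listₚ
open import Data.List.Relation.Unary.All as All using (All; []; _∷_)
import Data.List.Relation.Unary.All.Properties as Allₚ
open import Data.Vec using (Vec; []; _∷_)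
open import Relation.Unary using (Pred; Decidable)
open import Relation.Nullary using (Dec; yes; no; ¬_)
open import Relation.Nullary.Negation using (contradiction)
open import Relation.Binary.PropositionalEquality as ≡ using (_≡_; _≢_)
open import Algebra.Bundles using (CommutativeRing)

-- A partition of n is its multiplicity vector, and a sum over partitions with parts from a list ks
-- unfolds one part at a time (partSum); being a finite iterated sum it does not depend on the order
-- of ks, so any part i can be brought to the front.  For that part, (b)_x / x! z^x is the coefficient
-- of q^(i x) in (1 - z q^i)^(-b), and its logarithmic derivative gives
--   x · (b)_x / x! z^x = Σ_{t=1}^{x} b z^t · (b)_{x-t} / (x-t)! z^(x-t),
-- which, summed against the partition sum over the remaining parts (a Cauchy product), is part (b).
-- Part (c) is Σ_k k r_k = |π|, summed over the partitions π of n.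

module Sums {c ℓ : Level} (R : CommutativeRing c ℓ) where
  open CommutativeRing R hiding (zero)
  open import Relation.Binary.Reasoning.Setoid setoid
  open import Algebra.Solver.Ring.NaturalCoefficients.Default commutativeSemiring
    using (solve; _:=_; _:+_)

  Σ< : ℕ → (ℕ → Carrier) → Carrier
  Σ< zero    f = 0#
  Σ< (suc n) f = Σ< n f + f n

  Σ<-cong-< : ∀ n {f g} → (∀ j → j < n → f j ≈ g j) → Σ< n f ≈ Σ< n g
  Σ<-cong-< zero    f≈g = refl
  Σ<-cong-< (suc n) f≈g =
    +-cong (Σ<-cong-< n (λ j j<n → f≈g j (ℕₚ.m<n⇒m<1+n j<n))) (f≈g n ℕₚ.≤-refl)

  Σ<-cong : ∀ n {f g} → (∀ j → f j ≈ g j) → Σ< n f ≈ Σ< n g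
  Σ<-cong n f≈g = Σ<-cong-< n (λ j _ → f≈g j)

  Σ<-truncate : ∀ K M f → K ≤ M → (∀ t → K ≤ t → t < M → f t ≈ 0#) → Σ< M f ≈ Σ< K f
  Σ<-truncate K zero    f z≤n  vanish = refl
  Σ<-truncate K (suc M) f K≤1+M vanish with K ≟ suc M
  ... | yes ≡.refl = refl
  ... | no K≢1+M = begin
    Σ< M f + f M ≈⟨ +-cong (Σ<-truncate K M f K≤M (λ t K≤t t<M → vanish t K≤t (ℕₚ.m<n⇒m<1+n t<M)))
                           (vanish M K≤M ℕₚ.≤-refl) ⟩
    Σ< K f + 0#  ≈⟨ +-identityʳ _ ⟩
    Σ< K f       ∎
    where K≤M = ℕₚ.≤-pred (ℕₚ.≤∧≢⇒< K≤1+M K≢1+M)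

  Σ<-zero : ∀ n {f} → (∀ j → j < n → f j ≈ 0#) → Σ< n f ≈ 0#
  Σ<-zero n {f} vanish = Σ<-truncate 0 n f z≤n (λ j _ → vanish j)

  Σ<-sucˡ : ∀ n f → Σ< (suc n) f ≈ f 0 + Σ< n (λ j → f (suc j))
  Σ<-sucˡ zero    f = trans (+-identityˡ _) (sym (+-identityʳ _))
  Σ<-sucˡ (suc n) f = trans (+-cong (Σ<-sucˡ n f) refl) (+-assoc _ _ _)

  Σ<-distrib-+ : ∀ n f g → Σ< n (λ j → f j + g j) ≈ Σ< n f + Σ< n g
  Σ<-distrib-+ zero    f g = sym (+-identityˡ 0#)
  Σ<-distrib-+ (suc n) f g = trans (+-cong (Σ<-distrib-+ n f g) refl)
    (solve 4 (λ a b c d → (a :+ b) :+ (c :+ d) := (a :+ c) :+ (b :+ d)) refl _ _ _ _)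

  *-distribˡ-Σ< : ∀ n x f → x * Σ< n f ≈ Σ< n (λ j → x * f j)
  *-distribˡ-Σ< zero    x f = zeroʳ x
  *-distribˡ-Σ< (suc n) x f = trans (distribˡ x _ _) (+-cong (*-distribˡ-Σ< n x f) refl)

  *-distribʳ-Σ< : ∀ n x f → Σ< n f * x ≈ Σ< n (λ j → f j * x)
  *-distribʳ-Σ< n x f =
    trans (*-comm _ x) (trans (*-distribˡ-Σ< n x f) (Σ<-cong n (λ j → *-comm x (f j))))

  Σ<-comm : ∀ n m (f : ℕ → ℕ → Carrier) →
            Σ< n (λ i → Σ< m (f i)) ≈ Σ< m (λ j → Σ< n (λ i → f i j))
  Σ<-comm zero    m f = sym (Σ<-zero m (λ _ _ → refl))
  Σ<-comm (suc n) m f =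
    trans (+-cong (Σ<-comm n m f) refl) (sym (Σ<-distrib-+ m (λ j → Σ< n (λ i → f i j)) (f n)))

  infix 9 ⟦_⟧_

  ⟦_⟧_ : ∀ {p} {Q : Set p} → Dec Q → Carrier → Carrier
  ⟦ yes _ ⟧ x = x
  ⟦ no _  ⟧ _ = 0#

  module _ {p} {Q : Set p} where

    ⟦⟧-true : (d : Dec Q) {x : Carrier} → Q → ⟦ d ⟧ x ≈ x
    ⟦⟧-true (yes _) q = refl
    ⟦⟧-true (no ¬q) q = contradiction q ¬q

    ⟦⟧-false : (d : Dec Q) {x : Carrier} → ¬ Q → ⟦ d ⟧ x ≈ 0#
    ⟦⟧-false (yes q) ¬q = contradiction q ¬q
    ⟦⟧-false (no _)  ¬q = refl

    ⟦⟧-cong-if : (d : Dec Q) {x y : Carrier} → (Q → x ≈ y) → ⟦ d ⟧ x ≈ ⟦ d ⟧ y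
    ⟦⟧-cong-if (yes q) x≈y = x≈y q
    ⟦⟧-cong-if (no _)  x≈y = refl

    ⟦⟧-congʳ : (d : Dec Q) {x y : Carrier} → x ≈ y → ⟦ d ⟧ x ≈ ⟦ d ⟧ y
    ⟦⟧-congʳ d x≈y = ⟦⟧-cong-if d (λ _ → x≈y)

    *-⟦⟧ : (d : Dec Q) (x y : Carrier) → x * ⟦ d ⟧ y ≈ ⟦ d ⟧ (x * y)
    *-⟦⟧ (yes _) x y = refl
    *-⟦⟧ (no _)  x y = zeroʳ x

    ⟦⟧-Σ< : (d : Dec Q) → ∀ n f → ⟦ d ⟧ Σ< n f ≈ Σ< n (λ t → ⟦ d ⟧ f t)
    ⟦⟧-Σ< (yes _) n f = refl
    ⟦⟧-Σ< (no _)  n f = sym (Σ<-zero n (λ _ _ → refl))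

  ⟦⟧-cong : ∀ {p q} {A : Set p} {B : Set q} (d : Dec A) (e : Dec B) {x y} →
            (A → B) → (B → A) → (A → x ≈ y) → ⟦ d ⟧ x ≈ ⟦ e ⟧ y
  ⟦⟧-cong (yes a) (yes _) _   _   x≈y = x≈y a
  ⟦⟧-cong (yes a) (no ¬b) a→b _   _   = contradiction (a→b a) ¬b
  ⟦⟧-cong (no ¬a) (yes b) _   b→a _   = contradiction (b→a b) ¬a
  ⟦⟧-cong (no _)  (no _)  _   _   _   = refl

  ⟦≤?suc⟧ : ∀ p n x → ⟦ p ≤? suc n ⟧ x ≈ ⟦ p ≤? n ⟧ x + ⟦ p ≟ suc n ⟧ x
  ⟦≤?suc⟧ p n x with p ≤? n | p ≟ suc n
  ... | yes p≤n | e = trans (⟦⟧-true (p ≤? suc n) (ℕₚ.m≤n⇒m≤1+n p≤n))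
                            (sym (trans (+-cong refl (⟦⟧-false e (ℕₚ.<⇒≢ (s≤s p≤n)))) (+-identityʳ x)))
  ... | no _    | yes p≡1+n = trans (⟦⟧-true (p ≤? suc n) (ℕₚ.≤-reflexive p≡1+n)) (sym (+-identityˡ x))
  ... | no p≰n  | no p≢1+n =
    trans (⟦⟧-false (p ≤? suc n) (λ p≤1+n → p≰n (ℕₚ.≤-pred (ℕₚ.≤∧≢⇒< p≤1+n p≢1+n))))
          (sym (+-identityˡ 0#))

  ⟦+≟⟧ : ∀ p w n x y → ⟦ p ℕ.+ w ≟ n ⟧ (x * y) ≈ ⟦ p ≤? n ⟧ (x * ⟦ w ≟ n ∸ p ⟧ y)
  ⟦+≟⟧ p w n x y with p ≤? n
  ... | yes p≤n = trans (⟦⟧-cong (p ℕ.+ w ≟ n) (w ≟ n ∸ p)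
                          (λ e → ≡.trans (≡.sym (ℕₚ.m+n∸m≡n p w)) (≡.cong (_∸ p) e))
                          (λ e → ≡.trans (≡.cong (p ℕ.+_) e) (ℕₚ.m+[n∸m]≡n p≤n))
                          (λ _ → refl))
                        (sym (*-⟦⟧ (w ≟ n ∸ p) x y))
  ... | no p≰n = ⟦⟧-false (p ℕ.+ w ≟ n) (λ e → p≰n (≡.subst (p ≤_) e (ℕₚ.m≤m+n p w)))

  ⟦≤⟧-nested : ∀ N p n x (q : ℕ → ℕ) (g H : ℕ → Carrier) →
    ⟦ p ≤? n ⟧ (x * Σ< N (λ y → ⟦ q y ≤? n ∸ p ⟧ (g y * H (n ∸ p ∸ q y))))
    ≈ Σ< N (λ y → ⟦ p ℕ.+ q y ≤? n ⟧ (x * (g y * H (n ∸ (p ℕ.+ q y)))))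
  ⟦≤⟧-nested N p n x q g H with p ≤? n
  ... | yes p≤n = trans (*-distribˡ-Σ< N x _) (Σ<-cong N (λ y →
        trans (*-⟦⟧ (q y ≤? n ∸ p) x _)
              (⟦⟧-cong (q y ≤? n ∸ p) (p ℕ.+ q y ≤? n) (to p≤n) from
                       (λ _ → *-cong refl (*-cong refl (reflexive (≡.cong H (ℕₚ.∸-+-assoc n p (q y)))))))))
    where
    to : ∀ {p q n} → p ≤ n → q ≤ n ∸ p → p ℕ.+ q ≤ n
    to {p} {q} {n} p≤n q≤n∸p = ≡.subst (_≤ n) (ℕₚ.+-comm q p) (ℕₚ.m≤o∸n⇒m+n≤o q p≤n q≤n∸p)
    from : ∀ {p q n} → p ℕ.+ q ≤ n → q ≤ n ∸ p
    from {p} {q} {n} p+q≤n = ℕₚ.m+n≤o⇒m≤o∸n q (≡.subst (_≤ n) (ℕₚ.+-comm p q) p+q≤n)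
  ... | no p≰n =
    sym (Σ<-zero N (λ y _ → ⟦⟧-false (p ℕ.+ q y ≤? n) (λ le → p≰n (ℕₚ.m+n≤o⇒m≤o p le))))

  Σ<-shift : ∀ N t ψ → Σ< N (λ x → ⟦ t ≤? x ⟧ ψ (x ∸ t)) ≈ Σ< (N ∸ t) ψ
  Σ<-shift zero    t ψ = reflexive (≡.cong (λ k → Σ< k ψ) (≡.sym (ℕₚ.0∸n≡0 t)))
  Σ<-shift (suc N) t ψ with t ≤? N
  ... | yes t≤N = begin
    Σ< N (λ x → ⟦ t ≤? x ⟧ ψ (x ∸ t)) + ψ (N ∸ t) ≈⟨ +-cong (Σ<-shift N t ψ) refl ⟩
    Σ< (N ∸ t) ψ + ψ (N ∸ t)                       ≡⟨ ≡.cong (λ k → Σ< k ψ)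
                                                              (≡.sym (ℕₚ.+-∸-assoc 1 t≤N)) ⟩
    Σ< (suc N ∸ t) ψ                               ∎
  ... | no t≰N = begin
    Σ< N (λ x → ⟦ t ≤? x ⟧ ψ (x ∸ t)) + 0# ≈⟨ +-identityʳ _ ⟩
    Σ< N (λ x → ⟦ t ≤? x ⟧ ψ (x ∸ t))      ≈⟨ Σ<-shift N t ψ ⟩
    Σ< (N ∸ t) ψ                            ≡⟨ ≡.cong (λ k → Σ< k ψ) (≡.trans (ℕₚ.m≤n⇒m∸n≡0 N≤t)
                                                 (≡.sym (ℕₚ.m≤n⇒m∸n≡0 (ℕₚ.≰⇒> t≰N)))) ⟩
    Σ< (suc N ∸ t) ψ                        ∎
    where N≤t = ℕₚ.<⇒≤ (ℕₚ.≰⇒> t≰N)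

  Σ<-restrict : ∀ M x f → x ≤ M → Σ< M (λ t → ⟦ suc t ≤? x ⟧ f t) ≈ Σ< x f
  Σ<-restrict M x f x≤M = trans
    (Σ<-truncate x M _ x≤M (λ t x≤t _ → ⟦⟧-false (suc t ≤? x) (λ t<x → ℕₚ.<⇒≱ t<x x≤t)))
    (Σ<-cong-< x (λ t t<x → ⟦⟧-true (suc t ≤? x) t<x))

  Σ<-δ : ∀ M t₀ y → t₀ < M → Σ< M (λ t → ⟦ t ≟ t₀ ⟧ y) ≈ y
  Σ<-δ (suc M) t₀ y t₀<1+M with t₀ ≟ M
  ... | yes ≡.refl = trans (+-cong (Σ<-zero M (λ t t<M → ⟦⟧-false (t ≟ M) (ℕₚ.<⇒≢ t<M)))
                                   (⟦⟧-true (M ≟ M) ≡.refl))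
                           (+-identityˡ y)
  ... | no t₀≢M = trans (+-cong (Σ<-δ M t₀ y (ℕₚ.≤∧≢⇒< (ℕₚ.≤-pred t₀<1+M) t₀≢M))
                                (⟦⟧-false (M ≟ t₀) (λ e → t₀≢M (≡.sym e))))
                        (+-identityʳ y)

  -- Both sides sum α t · c y · H (n ∸ i x) over x = t + 1 + y with i x ≤ n.
  Σ<-cauchy : ∀ i n (α c H : ℕ → Carrier) → 1 ≤ i →
    Σ< n (λ t → ⟦ i ℕ.* suc t ≤? n ⟧
                  (α t * Σ< (suc n) (λ y → ⟦ i ℕ.* y ≤? n ∸ i ℕ.* suc t ⟧
                                             (c y * H (n ∸ i ℕ.* suc t ∸ i ℕ.* y)))))
    ≈ Σ< (suc n) (λ x → ⟦ i ℕ.* x ≤? n ⟧ (Σ< x (λ t → α t * c (x ∸ suc t)) * H (n ∸ i ℕ.* x)))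
  Σ<-cauchy i n α c H 1≤i = begin
    Σ< n (λ t → ⟦ i ℕ.* suc t ≤? n ⟧
                  (α t * Σ< (suc n) (λ y → ⟦ i ℕ.* y ≤? n ∸ i ℕ.* suc t ⟧
                                             (c y * H (n ∸ i ℕ.* suc t ∸ i ℕ.* y)))))
                                             ≈⟨ Σ<-cong n nest ⟩
    Σ< n (λ t → Σ< (suc n) (term t))         ≈⟨ sym (Σ<-cong-< n column) ⟩
    Σ< n (λ t → Σ< (suc n) (W t))            ≈⟨ sym (Σ<-comm (suc n) n (λ x t → W t x)) ⟩
    Σ< (suc n) (λ x → Σ< n (λ t → W t x))    ≈⟨ sym (Σ<-cong-< (suc n) row) ⟩
    Σ< (suc n) (λ x → ⟦ i ℕ.* x ≤? n ⟧ (Σ< x (λ t → α t * c (x ∸ suc t)) * H (n ∸ i ℕ.* x))) ∎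
    where
    term : ℕ → ℕ → Carrier
    term t y = ⟦ i ℕ.* (suc t ℕ.+ y) ≤? n ⟧ (α t * (c y * H (n ∸ i ℕ.* (suc t ℕ.+ y))))

    nest : ∀ t → ⟦ i ℕ.* suc t ≤? n ⟧
                   (α t * Σ< (suc n) (λ y → ⟦ i ℕ.* y ≤? n ∸ i ℕ.* suc t ⟧
                                              (c y * H (n ∸ i ℕ.* suc t ∸ i ℕ.* y))))
                 ≈ Σ< (suc n) (term t)
    nest t = trans (⟦≤⟧-nested (suc n) (i ℕ.* suc t) n (α t) (i ℕ.*_) c H)
                   (Σ<-cong (suc n) (λ y → reflexive (≡.cong (λ v → ⟦ v ≤? n ⟧ (α t * (c y * H (n ∸ v))))
                                                             (≡.sym (ℕₚ.*-distribˡ-+ i (suc t) y)))))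

    W : ℕ → ℕ → Carrier
    W t x = ⟦ suc t ≤? x ⟧ (⟦ i ℕ.* x ≤? n ⟧ (α t * c (x ∸ suc t) * H (n ∸ i ℕ.* x)))

    row : ∀ x → x < suc n →
          ⟦ i ℕ.* x ≤? n ⟧ (Σ< x (λ t → α t * c (x ∸ suc t)) * H (n ∸ i ℕ.* x)) ≈ Σ< n (λ t → W t x)
    row x x<1+n = begin
      ⟦ d ⟧ (Σ< x (λ t → α t * c (x ∸ suc t)) * Hx)   ≈⟨ ⟦⟧-congʳ d (*-distribʳ-Σ< x Hx _) ⟩
      ⟦ d ⟧ Σ< x (λ t → α t * c (x ∸ suc t) * Hx)     ≈⟨ ⟦⟧-Σ< d x _ ⟩
      Σ< x (λ t → ⟦ d ⟧ (α t * c (x ∸ suc t) * Hx))   ≈⟨ sym (Σ<-restrict n x _ (ℕₚ.≤-pred x<1+n)) ⟩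
      Σ< n (λ t → W t x)                               ∎
      where
      d = i ℕ.* x ≤? n
      Hx = H (n ∸ i ℕ.* x)

    column : ∀ t → t < n → Σ< (suc n) (W t) ≈ Σ< (suc n) (term t)
    column t t<n = begin
      Σ< (suc n) (W t)                                    ≈⟨ Σ<-cong (suc n) reindex ⟩
      Σ< (suc n) (λ x → ⟦ suc t ≤? x ⟧ term t (x ∸ suc t)) ≈⟨ Σ<-shift (suc n) (suc t) (term t) ⟩
      Σ< (n ∸ t) (term t)                                 ≈⟨ sym (Σ<-truncate (n ∸ t) (suc n) (term t)
                                                                   (ℕₚ.m≤n⇒m≤1+n (ℕₚ.m∸n≤m n t)) vanish) ⟩
      Σ< (suc n) (term t)                                 ∎
      where
      reindex : ∀ x → W t x ≈ ⟦ suc t ≤? x ⟧ term t (x ∸ suc t)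
      reindex x = ⟦⟧-cong-if (suc t ≤? x) (λ t<x →
        trans (reflexive (≡.cong (λ v → ⟦ i ℕ.* v ≤? n ⟧ (α t * c (x ∸ suc t) * H (n ∸ i ℕ.* v)))
                                 (≡.sym (ℕₚ.m+[n∸m]≡n t<x))))
              (⟦⟧-congʳ (i ℕ.* (suc t ℕ.+ (x ∸ suc t)) ≤? n) (*-assoc _ _ _)))
      vanish : ∀ y → n ∸ t ≤ y → y < suc n → term t y ≈ 0#
      vanish y n∸t≤y _ = ⟦⟧-false (i ℕ.* (suc t ℕ.+ y) ≤? n) (ℕₚ.<⇒≱ n<i[1+t+y])
        where
        n<1+t+y : n < suc t ℕ.+ y
        n<1+t+y = ≡.subst (λ m → suc m ≤ suc t ℕ.+ y) (ℕₚ.m+[n∸m]≡n (ℕₚ.<⇒≤ t<n))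
                          (ℕₚ.+-monoʳ-≤ (suc t) n∸t≤y)
        n<i[1+t+y] : n < i ℕ.* (suc t ℕ.+ y)
        n<i[1+t+y] = ℕₚ.<-≤-trans n<1+t+y (ℕₚ.m≤n*m (suc t ℕ.+ y) i {{ℕ.>-nonZero 1≤i}})

  sumL : List Carrier → Carrier
  sumL = foldr _+_ 0#

  module _ {a} {A : Set a} where

    sumL-map-cong : ∀ (xs : List A) {f g : A → Carrier} → (∀ x → f x ≈ g x) →
                    sumL (map f xs) ≈ sumL (map g xs)
    sumL-map-cong []       f≈g = refl
    sumL-map-cong (x ∷ xs) f≈g = +-cong (f≈g x) (sumL-map-cong xs f≈g)

    *-distribˡ-sumL : ∀ (xs : List A) (f : A → Carrier) y →
                      y * sumL (map f xs) ≈ sumL (map (λ x → y * f x) xs)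
    *-distribˡ-sumL []       f y = zeroʳ y
    *-distribˡ-sumL (x ∷ xs) f y = trans (distribˡ _ _ _) (+-cong refl (*-distribˡ-sumL xs f y))

    sumL-Σ<-comm : ∀ (xs : List A) n (φ : A → ℕ → Carrier) →
                   sumL (map (λ r → Σ< n (φ r)) xs) ≈ Σ< n (λ k → sumL (map (λ r → φ r k) xs))
    sumL-Σ<-comm []       n φ = sym (Σ<-zero n (λ _ _ → refl))
    sumL-Σ<-comm (x ∷ xs) n φ = trans (+-cong refl (sumL-Σ<-comm xs n φ))
                                      (sym (Σ<-distrib-+ n (φ x) (λ k → sumL (map (λ r → φ r k) xs))))

    sumL-filter : ∀ {p} {P : Pred A p} (P? : Decidable P) (g : A → Carrier) xs →
                  sumL (map g (filter P? xs)) ≈ sumL (map (λ x → ⟦ P? x ⟧ g x) xs)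
    sumL-filter P? g []       = refl
    sumL-filter P? g (x ∷ xs) with P? x
    ... | yes _ = +-cong refl (sumL-filter P? g xs)
    ... | no _  = trans (sumL-filter P? g xs) (sym (+-identityˡ _))

    sumL-⟦⟧ : ∀ {p} {Q : Set p} (d : Dec Q) y (h : A → Carrier) xs →
              sumL (map (λ r → ⟦ d ⟧ (y * h r)) xs) ≈ ⟦ d ⟧ (y * sumL (map h xs))
    sumL-⟦⟧ (yes _) y h xs = sym (*-distribˡ-sumL xs h y)
    sumL-⟦⟧ (no _)  y h []       = refl
    sumL-⟦⟧ (no q)  y h (_ ∷ xs) = trans (+-identityˡ _) (sumL-⟦⟧ (no q) y h xs)

    sumL-concat : (g : A → Carrier) (xss : List (List A)) →
                  sumL (map g (concat xss)) ≈ sumL (map (λ xs → sumL (map g xs)) xss)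
    sumL-concat g []         = refl
    sumL-concat g (xs ∷ xss) = begin
      sumL (map g (xs ++ concat xss))              ≡⟨ ≡.cong sumL (Listₚ.map-++ g xs (concat xss)) ⟩
      sumL (map g xs ++ map g (concat xss))        ≈⟨ sumL-++ (map g xs) (map g (concat xss)) ⟩
      sumL (map g xs) + sumL (map g (concat xss))  ≈⟨ +-cong refl (sumL-concat g xss) ⟩
      sumL (map g xs) + sumL (map (λ ys → sumL (map g ys)) xss) ∎
      where
      sumL-++ : ∀ us vs → sumL (us ++ vs) ≈ sumL us + sumL vs
      sumL-++ []       vs = sym (+-identityˡ _)
      sumL-++ (u ∷ us) vs = trans (+-cong refl (sumL-++ us vs)) (sym (+-assoc _ _ _))

    sumL-applyUpTo : ∀ N (h : ℕ → A) (φ : A → Carrier) →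
                     sumL (map φ (applyUpTo h N)) ≈ Σ< N (λ j → φ (h j))
    sumL-applyUpTo zero    h φ = refl
    sumL-applyUpTo (suc N) h φ =
      trans (+-cong refl (sumL-applyUpTo N (λ j → h (suc j)) φ)) (sym (Σ<-sucˡ N (λ j → φ (h j))))

  natR-+ : ∀ m n → natR R (m ℕ.+ n) ≈ natR R m + natR R n
  natR-+ zero    n = sym (+-identityˡ _)
  natR-+ (suc m) n = trans (+-cong refl (natR-+ m n)) (sym (+-assoc _ _ _))

  natR-* : ∀ m n → natR R (m ℕ.* n) ≈ natR R m * natR R n
  natR-* zero    n = sym (zeroˡ _)
  natR-* (suc m) n = begin
    natR R (n ℕ.+ m ℕ.* n)              ≈⟨ natR-+ n (m ℕ.* n) ⟩
    natR R n + natR R (m ℕ.* n)         ≈⟨ +-cong (sym (*-identityˡ _)) (natR-* m n) ⟩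
    1# * natR R n + natR R m * natR R n ≈⟨ sym (distribʳ _ _ _) ⟩
    (1# + natR R m) * natR R n          ∎

module PartitionSums {c ℓ : Level} (R : CommutativeRing c ℓ) where
  open CommutativeRing R hiding (zero)
  open Sums R
  open import Relation.Binary.Reasoning.Setoid setoid
  open import Algebra.Solver.Ring.NaturalCoefficients.Default commutativeSemiring
    using (solve; _:=_; _:*_)

  -- f k x is the weight of the part k occurring with multiplicity x.
  Fam : Set c
  Fam = ℕ → ℕ → Carrier

  weightWith : ∀ {m} → Fam → ℕ → Vec ℕ m → Carrier
  weightWith f s []       = 1#
  weightWith f s (x ∷ xs) = f (suc s) x * weightWith f (suc s) xs

  range : ℕ → ℕ → List ℕ
  range s zero    = []
  range s (suc m) = suc s ∷ range (suc s) m

  All-range : ∀ {p} (Q : ℕ → Set p) s m → (∀ k → s < k → k ≤ s ℕ.+ m → Q k) → All Q (range s m)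
  All-range Q s zero    h = []
  All-range Q s (suc m) h =
    h (suc s) ℕₚ.≤-refl (ℕₚ.m<m+n s z<s)
    ∷ All-range Q (suc s) m (λ k s<k k≤ → h k (ℕₚ.<⇒≤ s<k) (≡.subst (k ≤_) (≡.sym (ℕₚ.+-suc s m)) k≤))

  -- Sum over all multiplicities x_k ≤ B of the parts k ∈ ks with Σ k x_k = n of Π f k x_k.
  partSum : ℕ → List ℕ → Fam → ℕ → Carrier
  partSum B []       f n = ⟦ n ≟ 0 ⟧ 1#
  partSum B (k ∷ ks) f n =
    Σ< (suc B) (λ x → ⟦ k ℕ.* x ≤? n ⟧ (f k x * partSum B ks f (n ∸ k ℕ.* x)))

  sumL-box≈partSum : ∀ B m s n f →
    sumL (map (weightWith f s) (filter (λ r → weight′ s r ≟ n) (box B m))) ≈ partSum B (range s m) f n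
  sumL-box≈partSum B zero s n f =
    trans (sumL-filter (λ r → weight′ s r ≟ n) (weightWith f s) (box B zero))
          (trans (+-identityʳ _) (⟦⟧-cong (0 ≟ n) (n ≟ 0) ≡.sym ≡.sym (λ _ → refl)))
  sumL-box≈partSum B (suc m) s n f = begin
    sumL (map (weightWith f s) (filter (λ r → weight′ s r ≟ n) (box B (suc m))))
      ≈⟨ sumL-filter (λ r → weight′ s r ≟ n) (weightWith f s) (box B (suc m)) ⟩
    sumL (map g (concat (map rows (applyUpTo (λ j → j) (suc B)))))
      ≈⟨ sumL-concat g (map rows (applyUpTo (λ j → j) (suc B))) ⟩
    sumL (map (λ l → sumL (map g l)) (map rows (applyUpTo (λ j → j) (suc B))))
      ≡⟨ ≡.sym (≡.cong sumL (Listₚ.map-∘ (applyUpTo (λ j → j) (suc B)))) ⟩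
    sumL (map (λ x → sumL (map g (rows x))) (applyUpTo (λ j → j) (suc B)))
      ≈⟨ sumL-applyUpTo (suc B) (λ j → j) _ ⟩
    Σ< (suc B) (λ x → sumL (map g (rows x)))
      ≈⟨ Σ<-cong (suc B) row ⟩
    partSum B (range s (suc m)) f n ∎
    where
    k = suc s
    g = λ r → ⟦ weight′ s r ≟ n ⟧ weightWith f s r
    rows = λ x → map (x ∷_) (box B m)
    row : ∀ x → sumL (map g (rows x)) ≈ ⟦ k ℕ.* x ≤? n ⟧ (f k x * partSum B (range k m) f (n ∸ k ℕ.* x))
    row x = begin
      sumL (map g (rows x))
        ≡⟨ ≡.sym (≡.cong sumL (Listₚ.map-∘ (box B m))) ⟩
      sumL (map (λ r → ⟦ k ℕ.* x ℕ.+ weight′ k r ≟ n ⟧ (f k x * weightWith f k r)) (box B m))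
        ≈⟨ sumL-map-cong (box B m) (λ r → ⟦+≟⟧ (k ℕ.* x) (weight′ k r) n (f k x) (weightWith f k r)) ⟩
      sumL (map (λ r → ⟦ k ℕ.* x ≤? n ⟧ (f k x * ⟦ weight′ k r ≟ n ∸ k ℕ.* x ⟧ weightWith f k r)) (box B m))
        ≈⟨ sumL-⟦⟧ (k ℕ.* x ≤? n) (f k x) _ (box B m) ⟩
      ⟦ k ℕ.* x ≤? n ⟧ (f k x * sumL (map (λ r → ⟦ weight′ k r ≟ n ∸ k ℕ.* x ⟧ weightWith f k r) (box B m)))
        ≈⟨ ⟦⟧-congʳ (k ℕ.* x ≤? n) (*-cong refl (trans
             (sym (sumL-filter (λ r → weight′ k r ≟ n ∸ k ℕ.* x) (weightWith f k) (box B m)))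
             (sumL-box≈partSum B m k (n ∸ k ℕ.* x) f))) ⟩
      ⟦ k ℕ.* x ≤? n ⟧ (f k x * partSum B (range k m) f (n ∸ k ℕ.* x)) ∎

  partSum-cong-head : ∀ B k ks ks′ f g n → (∀ x → f k x ≈ g k x) →
                      (∀ m → partSum B ks f m ≈ partSum B ks′ g m) →
                      partSum B (k ∷ ks) f n ≈ partSum B (k ∷ ks′) g n
  partSum-cong-head B k ks ks′ f g n f≈g tail≈ =
    Σ<-cong (suc B) (λ x → ⟦⟧-congʳ (k ℕ.* x ≤? n) (*-cong (f≈g x) (tail≈ _)))

  partSum-cong : ∀ B ks f g → All (λ k → ∀ x → f k x ≈ g k x) ks →
                 ∀ n → partSum B ks f n ≈ partSum B ks g n
  partSum-cong B []       f g []           n = refl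
  partSum-cong B (k ∷ ks) f g (f≈g ∷ f≈gs) n =
    partSum-cong-head B k ks ks f g n f≈g (partSum-cong B ks f g f≈gs)

  -- Multiplicities beyond n contribute nothing.
  partSum-bound : ∀ B B′ ks f n → All (1 ≤_) ks → n ≤ B → n ≤ B′ →
                  partSum B ks f n ≈ partSum B′ ks f n
  partSum-bound B B′ []       f n _           _   _    = refl
  partSum-bound B B′ (k ∷ ks) f n (1≤k ∷ 1≤ks) n≤B n≤B′ = begin
    Σ< (suc B) (ψ B)   ≈⟨ Σ<-truncate (suc n) (suc B) (ψ B) (s≤s n≤B) (vanish B) ⟩
    Σ< (suc n) (ψ B)   ≈⟨ Σ<-cong (suc n) (λ x → ⟦⟧-congʳ (k ℕ.* x ≤? n) (*-cong refl
                            (partSum-bound B B′ ks f (n ∸ k ℕ.* x) 1≤ks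
                                           (ℕₚ.≤-trans (ℕₚ.m∸n≤m n (k ℕ.* x)) n≤B)
                                           (ℕₚ.≤-trans (ℕₚ.m∸n≤m n (k ℕ.* x)) n≤B′)))) ⟩
    Σ< (suc n) (ψ B′)  ≈⟨ sym (Σ<-truncate (suc n) (suc B′) (ψ B′) (s≤s n≤B′) (vanish B′)) ⟩
    Σ< (suc B′) (ψ B′) ∎
    where
    ψ : ℕ → ℕ → Carrier
    ψ C x = ⟦ k ℕ.* x ≤? n ⟧ (f k x * partSum C ks f (n ∸ k ℕ.* x))
    vanish : ∀ C x → suc n ≤ x → x < suc C → ψ C x ≈ 0#
    vanish C x n<x _ = ⟦⟧-false (k ℕ.* x ≤? n)
      (ℕₚ.<⇒≱ (ℕₚ.<-≤-trans n<x (ℕₚ.m≤n*m x k {{ℕ.>-nonZero 1≤k}})))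

  -- Parts larger than n can only occur with multiplicity 0.
  partSum-++-large : ∀ B ks es f N n → All (N <_) es → All (λ e → f e 0 ≈ 1#) es → n ≤ N →
                     partSum B (ks ++ es) f n ≈ partSum B ks f n
  partSum-++-large B (k ∷ ks) es f N n large unit n≤N =
    Σ<-cong (suc B) (λ x → ⟦⟧-congʳ (k ℕ.* x ≤? n) (*-cong refl
      (partSum-++-large B ks es f N (n ∸ k ℕ.* x) large unit (ℕₚ.≤-trans (ℕₚ.m∸n≤m n (k ℕ.* x)) n≤N))))
  partSum-++-large B [] []       f N n _               _             _   = refl
  partSum-++-large B [] (e ∷ es) f N n (N<e ∷ large) (fe0≈1 ∷ unit) n≤N = begin
    Σ< (suc B) ψ                  ≈⟨ Σ<-sucˡ B ψ ⟩
    ψ 0 + Σ< B (λ j → ψ (suc j))  ≈⟨ +-cong ψ0 (Σ<-zero B (λ j _ → ⟦⟧-false (e ℕ.* suc j ≤? n) (too-big j))) ⟩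
    partSum B [] f n + 0#         ≈⟨ +-identityʳ _ ⟩
    partSum B [] f n              ∎
    where
    ψ = λ x → ⟦ e ℕ.* x ≤? n ⟧ (f e x * partSum B es f (n ∸ e ℕ.* x))
    too-big : ∀ j → ¬ (e ℕ.* suc j ≤ n)
    too-big j le = ℕₚ.<⇒≱ (ℕₚ.<-≤-trans N<e (ℕₚ.m≤m*n e (suc j))) (ℕₚ.≤-trans le n≤N)
    ψ0 : ψ 0 ≈ partSum B [] f n
    ψ0 = begin
      ψ 0                               ≈⟨ ⟦⟧-true (e ℕ.* 0 ≤? n) (≡.subst (_≤ n) (≡.sym (ℕₚ.*-zeroʳ e)) z≤n) ⟩
      f e 0 * partSum B es f (n ∸ e ℕ.* 0) ≡⟨ ≡.cong (λ m → f e 0 * partSum B es f (n ∸ m)) (ℕₚ.*-zeroʳ e) ⟩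
      f e 0 * partSum B es f n          ≈⟨ trans (*-cong fe0≈1 refl) (*-identityˡ _) ⟩
      partSum B es f n                  ≈⟨ partSum-++-large B [] es f N n large unit n≤N ⟩
      partSum B [] f n                  ∎

  partSum-swap : ∀ B k₁ k₂ ks f n → partSum B (k₁ ∷ k₂ ∷ ks) f n ≈ partSum B (k₂ ∷ k₁ ∷ ks) f n
  partSum-swap B k₁ k₂ ks f n = begin
    partSum B (k₁ ∷ k₂ ∷ ks) f n
      ≈⟨ Σ<-cong (suc B) (λ x → ⟦≤⟧-nested (suc B) (k₁ ℕ.* x) n (f k₁ x) (k₂ ℕ.*_) (f k₂) (partSum B ks f)) ⟩
    Σ< (suc B) (λ x → Σ< (suc B) (λ y → T k₁ k₂ x y))
      ≈⟨ Σ<-comm (suc B) (suc B) (T k₁ k₂) ⟩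
    Σ< (suc B) (λ y → Σ< (suc B) (λ x → T k₁ k₂ x y))
      ≈⟨ Σ<-cong (suc B) (λ y → Σ<-cong (suc B) (λ x → T-comm x y)) ⟩
    Σ< (suc B) (λ y → Σ< (suc B) (λ x → T k₂ k₁ y x))
      ≈⟨ sym (Σ<-cong (suc B) (λ y → ⟦≤⟧-nested (suc B) (k₂ ℕ.* y) n (f k₂ y) (k₁ ℕ.*_) (f k₁) (partSum B ks f))) ⟩
    partSum B (k₂ ∷ k₁ ∷ ks) f n ∎
    where
    T : ℕ → ℕ → ℕ → ℕ → Carrier
    T k k′ x y = ⟦ k ℕ.* x ℕ.+ k′ ℕ.* y ≤? n ⟧ (f k x * (f k′ y * partSum B ks f (n ∸ (k ℕ.* x ℕ.+ k′ ℕ.* y))))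
    T-comm : ∀ x y → T k₁ k₂ x y ≈ T k₂ k₁ y x
    T-comm x y = ⟦⟧-cong (k₁ ℕ.* x ℕ.+ k₂ ℕ.* y ≤? n) (k₂ ℕ.* y ℕ.+ k₁ ℕ.* x ≤? n)
      (≡.subst (_≤ n) (ℕₚ.+-comm (k₁ ℕ.* x) (k₂ ℕ.* y)))
      (≡.subst (_≤ n) (ℕₚ.+-comm (k₂ ℕ.* y) (k₁ ℕ.* x)))
      (λ _ → trans (solve 3 (λ u v w → u :* (v :* w) := v :* (u :* w)) refl (f k₁ x) (f k₂ y) _)
                   (*-cong refl (*-cong refl (reflexive (≡.cong (λ m → partSum B ks f (n ∸ m))
                                                               (ℕₚ.+-comm (k₁ ℕ.* x) (k₂ ℕ.* y)))))))

  partSum-front : ∀ B ks k ks′ f n → partSum B (ks ++ k ∷ ks′) f n ≈ partSum B (k ∷ ks ++ ks′) f n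
  partSum-front B []        k ks′ f n = refl
  partSum-front B (k₁ ∷ ks) k ks′ f n =
    trans (partSum-cong-head B k₁ (ks ++ k ∷ ks′) (k ∷ ks ++ ks′) f f n (λ _ → refl) (partSum-front B ks k ks′ f))
          (partSum-swap B k₁ k (ks ++ ks′) f n)

  range-+ : ∀ s m m′ → range s (m ℕ.+ m′) ≡ range s m ++ range (s ℕ.+ m) m′
  range-+ s zero    m′ = ≡.cong (λ t → range t m′) (≡.sym (ℕₚ.+-identityʳ s))
  range-+ s (suc m) m′ = ≡.cong (suc s ∷_) (≡.trans (range-+ (suc s) m m′)
    (≡.cong (λ t → range (suc s) m ++ range t m′) (≡.sym (ℕₚ.+-suc s m))))

module Theorem {c ℓ : Level} (R : CommutativeRing c ℓ) (inv : ℕ → CommutativeRing.Carrier R)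
  (inv-inverse : ∀ n → CommutativeRing._≈_ R (CommutativeRing._*_ R (natR R (suc n)) (inv (suc n)))
                                             (CommutativeRing.1# R))
  (z : CommutativeRing.Carrier R) (b : ℕ → CommutativeRing.Carrier R) where
  open CommutativeRing R hiding (zero)
  open Setup R inv z b hiding (sumL)
  open Sums R
  open PartitionSums R
  open import Relation.Binary.Reasoning.Setoid setoid
  open import Algebra.Solver.Ring.NaturalCoefficients.Default commutativeSemiring
    using (solve; _:=_; _:*_)

  pow-+ : ∀ x m n → pow x (m ℕ.+ n) ≈ pow x m * pow x n
  pow-+ x zero    n = sym (*-identityˡ _)
  pow-+ x (suc m) n = trans (*-cong refl (pow-+ x m n)) (sym (*-assoc _ _ _))

  nat*inv≈1 : ∀ N .{{_ : ℕ.NonZero N}} → nat N * inv N ≈ 1#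
  nat*inv≈1 (suc N) = inv-inverse N

  nat*inv-! : ∀ x → nat (suc x) * inv (suc x ℕ.!) ≈ inv (x ℕ.!)
  nat*inv-! x = sym (begin
    w                                   ≈⟨ sym (*-identityʳ w) ⟩
    w * 1#                              ≈⟨ *-cong refl (sym (nat*inv≈1 (suc x ℕ.!) {{ℕₚ._!≢0 (suc x)}})) ⟩
    w * (nat (suc x ℕ.* x ℕ.!) * y)     ≈⟨ *-cong refl (*-cong (natR-* (suc x) (x ℕ.!)) refl) ⟩
    w * ((nat (suc x) * nat (x ℕ.!)) * y)
      ≈⟨ solve 4 (λ w a f y → w :* ((a :* f) :* y) := (f :* w) :* (a :* y)) refl _ _ _ _ ⟩
    (nat (x ℕ.!) * w) * (nat (suc x) * y) ≈⟨ *-cong (nat*inv≈1 (x ℕ.!) {{ℕₚ._!≢0 x}}) refl ⟩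
    1# * (nat (suc x) * y)              ≈⟨ *-identityˡ _ ⟩
    nat (suc x) * y                     ∎)
    where
    w = inv (x ℕ.!)
    y = inv (suc x ℕ.!)

  -- The coefficient of z^x in (1 - z)^(-B).
  coeff : Carrier → ℕ → Carrier
  coeff B x = poch B x * inv (x ℕ.!)

  -- The logarithmic derivative of (1 - z)^(-B) is B / (1 - z).
  nat*coeff : ∀ B x → nat x * coeff B x ≈ B * Σ< x (λ t → coeff B (x ∸ suc t))
  nat*coeff B zero    = trans (zeroˡ _) (sym (zeroʳ B))
  nat*coeff B (suc x) = begin
    nat (suc x) * (poch B x * (B + nat x) * inv (suc x ℕ.!))
      ≈⟨ solve 4 (λ a p q y → a :* ((p :* q) :* y) := q :* (p :* (a :* y))) refl
                 (nat (suc x)) (poch B x) (B + nat x) (inv (suc x ℕ.!)) ⟩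
    (B + nat x) * (poch B x * (nat (suc x) * inv (suc x ℕ.!)))
      ≈⟨ *-cong refl (*-cong refl (nat*inv-! x)) ⟩
    (B + nat x) * coeff B x                           ≈⟨ distribʳ _ _ _ ⟩
    B * coeff B x + nat x * coeff B x                 ≈⟨ +-cong refl (nat*coeff B x) ⟩
    B * coeff B x + B * Σ< x (λ t → coeff B (x ∸ suc t)) ≈⟨ sym (distribˡ _ _ _) ⟩
    B * (coeff B x + Σ< x (λ t → coeff B (x ∸ suc t)))   ≈⟨ *-cong refl (sym (Σ<-sucˡ x (λ t → coeff B (x ∸ t)))) ⟩
    B * Σ< (suc x) (λ t → coeff B (suc x ∸ suc t))       ∎

  factor : Fam
  factor k x = coeff (b k) x * pow z x

  factor-0 : ∀ k → factor k 0 ≈ 1#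
  factor-0 k = trans (*-identityʳ _) (trans (*-identityˡ _) inv-1)
    where
    inv-1 : inv 1 ≈ 1#
    inv-1 = trans (sym (*-identityˡ _)) (trans (*-cong (sym (+-identityʳ 1#)) refl) (inv-inverse 0))

  nat*factor : ∀ i x → nat x * factor i x ≈ Σ< x (λ t → b i * pow z (suc t) * factor i (x ∸ suc t))
  nat*factor i x = begin
    nat x * (coeff B x * pow z x)                      ≈⟨ sym (*-assoc _ _ _) ⟩
    nat x * coeff B x * pow z x                        ≈⟨ *-cong (nat*coeff B x) refl ⟩
    B * Σ< x (λ t → coeff B (x ∸ suc t)) * pow z x     ≈⟨ *-assoc _ _ _ ⟩
    B * (Σ< x (λ t → coeff B (x ∸ suc t)) * pow z x)   ≈⟨ *-cong refl (*-distribʳ-Σ< x (pow z x) _) ⟩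
    B * Σ< x (λ t → coeff B (x ∸ suc t) * pow z x)     ≈⟨ *-distribˡ-Σ< x B _ ⟩
    Σ< x (λ t → B * (coeff B (x ∸ suc t) * pow z x))   ≈⟨ Σ<-cong-< x split-pow ⟩
    Σ< x (λ t → B * pow z (suc t) * factor i (x ∸ suc t)) ∎
    where
    B = b i
    split-pow : ∀ t → t < x → B * (coeff B (x ∸ suc t) * pow z x) ≈ B * pow z (suc t) * factor i (x ∸ suc t)
    split-pow t t<x = begin
      B * (coeff B (x ∸ suc t) * pow z x)
        ≡⟨ ≡.cong (λ m → B * (coeff B (x ∸ suc t) * pow z m)) (≡.sym (ℕₚ.m+[n∸m]≡n t<x)) ⟩
      B * (coeff B (x ∸ suc t) * pow z (suc t ℕ.+ (x ∸ suc t)))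
        ≈⟨ *-cong refl (*-cong refl (pow-+ z (suc t) (x ∸ suc t))) ⟩
      B * (coeff B (x ∸ suc t) * (pow z (suc t) * pow z (x ∸ suc t)))
        ≈⟨ solve 4 (λ b v p q → b :* (v :* (p :* q)) := (b :* p) :* (v :* q)) refl B _ _ _ ⟩
      B * pow z (suc t) * factor i (x ∸ suc t) ∎

  weightTerm′≡weightWith : ∀ s {m} (r : Vec ℕ m) → weightTerm′ s r ≡ weightWith factor s r
  weightTerm′≡weightWith s []      = ≡.refl
  weightTerm′≡weightWith s (x ∷ r) = ≡.cong (factor (suc s) x *_) (weightTerm′≡weightWith (suc s) r)

  P0≈1 : P 0 ≈ 1#
  P0≈1 = +-identityʳ 1#

  P≈partSum : ∀ n → P n ≈ partSum n (range 0 n) factor n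
  P≈partSum n = trans (sumL-map-cong (partitions n) (λ r → reflexive (weightTerm′≡weightWith 0 r)))
                      (sumL-box≈partSum n n 0 n factor)

  P≈partSum-range : ∀ {m n} → m ≤ n → P m ≈ partSum n (range 0 n) factor m
  P≈partSum-range {m} {n} m≤n = begin
    P m                                        ≈⟨ P≈partSum m ⟩
    partSum m (range 0 m) factor m             ≈⟨ partSum-bound m n (range 0 m) factor m
                                                    (All-range _ 0 m (λ k 0<k _ → 0<k)) ℕₚ.≤-refl m≤n ⟩
    partSum n (range 0 m) factor m             ≈⟨ sym (partSum-++-large n (range 0 m) (range m (n ∸ m)) factor m m
                                                    (All-range _ m (n ∸ m) (λ k m<k _ → m<k))
                                                    (All-range _ m (n ∸ m) (λ k _ _ → factor-0 k)) ℕₚ.≤-refl) ⟩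
    partSum n (range 0 m ++ range m (n ∸ m)) factor m
      ≡⟨ ≡.cong (λ ks → partSum n ks factor m)
                (≡.trans (≡.sym (range-+ 0 m (n ∸ m))) (≡.cong (range 0) (ℕₚ.m+[n∸m]≡n m≤n))) ⟩
    partSum n (range 0 n) factor m             ∎

  sumFrom1≈Σ< : ∀ n h → sumFrom1 n h ≈ Σ< n (λ k → h (suc k))
  sumFrom1≈Σ< zero    h = refl
  sumFrom1≈Σ< (suc n) h = +-cong (sumFrom1≈Σ< n h) refl

  -- The filter r_k > 0 in F only drops terms that carry the factor r_k = 0.
  F≈sum-mult : ∀ k n → F k n ≈ sumL (map (λ r → nat (mult r k) * weightTerm r) (partitions n))
  F≈sum-mult k n = trans (sumL-filter (λ r → 1 ≤? mult r k) _ (partitions n))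
                         (sumL-map-cong (partitions n) (λ r → drop-0 (mult r k) (weightTerm r)))
    where
    drop-0 : ∀ m w → ⟦ 1 ≤? m ⟧ (nat m * w) ≈ nat m * w
    drop-0 zero    w = sym (zeroˡ w)
    drop-0 (suc m) w = refl

  nat-weight′ : ∀ s {m} (r : Vec ℕ m) →
                nat (weight′ s r) ≈ Σ< m (λ k → nat (s ℕ.+ suc k) * nat (mult r (suc k)))
  nat-weight′ s []               = refl
  nat-weight′ s {suc m} (x ∷ xs) = begin
    nat (suc s ℕ.* x ℕ.+ weight′ (suc s) xs)
      ≈⟨ trans (natR-+ (suc s ℕ.* x) (weight′ (suc s) xs))
               (+-cong (natR-* (suc s) x) (nat-weight′ (suc s) xs)) ⟩
    nat (suc s) * nat x + Σ< m (λ k → nat (suc s ℕ.+ suc k) * nat (mult xs (suc k)))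
      ≈⟨ +-cong (reflexive (≡.cong (λ u → nat u * nat x) (ℕₚ.+-comm 1 s)))
                (Σ<-cong m (λ k → reflexive (≡.cong (λ u → nat u * nat (mult xs (suc k)))
                                                    (≡.sym (ℕₚ.+-suc s (suc k)))))) ⟩
    nat (s ℕ.+ 1) * nat x + Σ< m (λ k → nat (s ℕ.+ suc (suc k)) * nat (mult xs (suc k)))
      ≈⟨ sym (Σ<-sucˡ m (λ k → nat (s ℕ.+ suc k) * nat (mult (x ∷ xs) (suc k)))) ⟩
    Σ< (suc m) (λ k → nat (s ℕ.+ suc k) * nat (mult (x ∷ xs) (suc k))) ∎

  Σ-kF≈nP : ∀ n → sumFrom1 n (λ k → k · F k n) ≈ n · P n
  Σ-kF≈nP n = begin
    sumFrom1 n (λ k → k · F k n)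
      ≈⟨ sumFrom1≈Σ< n _ ⟩
    Σ< n (λ k → nat (suc k) * F (suc k) n)
      ≈⟨ Σ<-cong n (λ k → trans (*-cong refl (F≈sum-mult (suc k) n)) (*-distribˡ-sumL ps _ (nat (suc k)))) ⟩
    Σ< n (λ k → sumL (map (λ r → φ r k) ps))
      ≈⟨ sym (sumL-Σ<-comm ps n φ) ⟩
    sumL (map (λ r → Σ< n (φ r)) ps)
      ≈⟨ sumL-map-cong ps Σφ≈weight ⟩
    sumL (map (λ r → nat (weight r) * weightTerm r) ps)
      ≈⟨ sumL-filter (λ r → weight r ≟ n) _ (box n n) ⟩
    sumL (map (λ r → ⟦ weight r ≟ n ⟧ (nat (weight r) * weightTerm r)) (box n n))
      ≈⟨ sumL-map-cong (box n n) (λ r → ⟦⟧-cong-if (weight r ≟ n) (λ e → *-cong (reflexive (≡.cong nat e)) refl)) ⟩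
    sumL (map (λ r → ⟦ weight r ≟ n ⟧ (nat n * weightTerm r)) (box n n))
      ≈⟨ sym (sumL-filter (λ r → weight r ≟ n) _ (box n n)) ⟩
    sumL (map (λ r → nat n * weightTerm r) ps)
      ≈⟨ sym (*-distribˡ-sumL ps weightTerm (nat n)) ⟩
    n · P n ∎
    where
    ps = partitions n
    φ : Vec ℕ n → ℕ → Carrier
    φ r k = nat (suc k) * (nat (mult r (suc k)) * weightTerm r)
    Σφ≈weight : ∀ r → Σ< n (φ r) ≈ nat (weight r) * weightTerm r
    Σφ≈weight r = begin
      Σ< n (φ r)                                                        ≈⟨ Σ<-cong n (λ k → sym (*-assoc _ _ _)) ⟩
      Σ< n (λ k → nat (suc k) * nat (mult r (suc k)) * weightTerm r)    ≈⟨ sym (*-distribʳ-Σ< n (weightTerm r) _) ⟩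
      Σ< n (λ k → nat (suc k) * nat (mult r (suc k))) * weightTerm r    ≈⟨ *-cong (sym (nat-weight′ 0 r)) refl ⟩
      nat (weight r) * weightTerm r                                     ∎

  a-as-Σ< : ∀ i .{{_ : ℕ.NonZero i}} M n (Ψ : ℕ → Carrier) → suc n ≤ M →
            Σ< M (λ t → ⟦ i ℕ.* suc t ≟ suc n ⟧ (b i * pow z (suc t) * Ψ (i ℕ.* suc t)))
            ≈ a i (suc n) * Ψ (suc n)
  a-as-Σ< i M n Ψ 1+n≤M with i ∣? suc n
  ... | yes (divides zero 1+n≡0) = contradiction 1+n≡0 λ ()
  ... | yes (divides (suc r) 1+n≡[1+r]i) = trans (Σ<-cong M only-r) (Σ<-δ M r _ 1+r≤M)
    where
    i[1+r]≡1+n : i ℕ.* suc r ≡ suc n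
    i[1+r]≡1+n = ≡.trans (ℕₚ.*-comm i (suc r)) (≡.sym 1+n≡[1+r]i)
    to-r : ∀ t → i ℕ.* suc t ≡ suc n → t ≡ r
    to-r t e = ℕₚ.suc-injective (ℕₚ.*-cancelˡ-≡ (suc t) (suc r) i (≡.trans e (≡.sym i[1+r]≡1+n)))
    1+r≤M : suc r ≤ M
    1+r≤M = ℕₚ.≤-trans (ℕₚ.m≤m*n (suc r) i) (≡.subst (_≤ M) 1+n≡[1+r]i 1+n≤M)
    only-r : ∀ t → ⟦ i ℕ.* suc t ≟ suc n ⟧ (b i * pow z (suc t) * Ψ (i ℕ.* suc t))
                   ≈ ⟦ t ≟ r ⟧ (b i * pow z (suc r) * Ψ (suc n))
    only-r t = ⟦⟧-cong (i ℕ.* suc t ≟ suc n) (t ≟ r) (to-r t)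
                       (λ t≡r → ≡.trans (≡.cong (λ v → i ℕ.* suc v) t≡r) i[1+r]≡1+n)
                       (λ e → reflexive (≡.cong₂ (λ v w → b i * pow z (suc v) * Ψ w) (to-r t e) e))
  ... | no i∤1+n = trans (Σ<-zero M (λ t _ → ⟦⟧-false (i ℕ.* suc t ≟ suc n)
                           (λ e → i∤1+n (divides (suc t) (≡.trans (≡.sym e) (ℕₚ.*-comm i (suc t)))))))
                         (sym (zeroˡ _))

  sumFrom1-a : ∀ i .{{_ : ℕ.NonZero i}} M (Ψ : ℕ → Carrier) n → n ≤ M →
               sumFrom1 n (λ j → a i j * Ψ j)
               ≈ Σ< M (λ t → ⟦ i ℕ.* suc t ≤? n ⟧ (b i * pow z (suc t) * Ψ (i ℕ.* suc t)))
  sumFrom1-a i M Ψ zero    _   = sym (Σ<-zero M (λ t _ → ⟦⟧-false (i ℕ.* suc t ≤? 0)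
                                     (ℕₚ.<⇒≱ (ℕₚ.<-≤-trans z<s (ℕₚ.m≤n*m (suc t) i)))))
  sumFrom1-a i M Ψ (suc n) 1+n≤M = begin
    sumFrom1 n (λ j → a i j * Ψ j) + a i (suc n) * Ψ (suc n)
      ≈⟨ +-cong (sumFrom1-a i M Ψ n (ℕₚ.<⇒≤ 1+n≤M)) (sym (a-as-Σ< i M n Ψ 1+n≤M)) ⟩
    Σ< M (λ t → ⟦ i ℕ.* suc t ≤? n ⟧ y t) + Σ< M (λ t → ⟦ i ℕ.* suc t ≟ suc n ⟧ y t)
      ≈⟨ sym (Σ<-distrib-+ M _ _) ⟩
    Σ< M (λ t → ⟦ i ℕ.* suc t ≤? n ⟧ y t + ⟦ i ℕ.* suc t ≟ suc n ⟧ y t)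
      ≈⟨ Σ<-cong M (λ t → sym (⟦≤?suc⟧ (i ℕ.* suc t) n (y t))) ⟩
    Σ< M (λ t → ⟦ i ℕ.* suc t ≤? suc n ⟧ y t) ∎
    where
    y = λ t → b i * pow z (suc t) * Ψ (i ℕ.* suc t)

  marked : ℕ → Fam
  marked i k x with k ≟ i
  ... | yes _ = nat x * factor k x
  ... | no _  = factor k x

  marked-self : ∀ i x → marked i i x ≈ nat x * factor i x
  marked-self i x with i ≟ i
  ... | yes _   = refl
  ... | no i≢i = contradiction ≡.refl i≢i

  marked-other : ∀ {i k} x → k ≢ i → marked i k x ≈ factor k x
  marked-other {i} {k} x k≢i with k ≟ i
  ... | yes k≡i = contradiction k≡i k≢i
  ... | no _    = refl

  weightWith-marked-above : ∀ i s {m} (r : Vec ℕ m) → i ≤ s → weightWith (marked i) s r ≈ weightWith factor s r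
  weightWith-marked-above i s []       _   = refl
  weightWith-marked-above i s (x ∷ xs) i≤s =
    *-cong (marked-other x (λ 1+s≡i → ℕₚ.1+n≰n (≡.subst (_≤ s) (≡.sym 1+s≡i) i≤s)))
           (weightWith-marked-above i (suc s) xs (ℕₚ.m≤n⇒m≤1+n i≤s))

  weightWith-marked : ∀ i s d {m} (r : Vec ℕ m) → d < m → i ≡ s ℕ.+ suc d →
                      weightWith (marked i) s r ≈ nat (mult r (suc d)) * weightWith factor s r
  weightWith-marked i s zero    (x ∷ xs) _ i≡s+1 = begin
    marked i (suc s) x * weightWith (marked i) (suc s) xs
      ≈⟨ *-cong (reflexive (≡.cong (λ k → marked k (suc s) x) i≡1+s))
                (weightWith-marked-above i (suc s) xs (ℕₚ.≤-reflexive i≡1+s)) ⟩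
    marked (suc s) (suc s) x * weightWith factor (suc s) xs
      ≈⟨ *-cong (marked-self (suc s) x) refl ⟩
    nat x * factor (suc s) x * weightWith factor (suc s) xs
      ≈⟨ *-assoc _ _ _ ⟩
    nat x * weightWith factor s (x ∷ xs) ∎
    where i≡1+s = ≡.trans i≡s+1 (ℕₚ.+-comm s 1)
  weightWith-marked i s (suc d) (x ∷ xs) (s≤s d<m) i≡s+2+d = begin
    marked i (suc s) x * weightWith (marked i) (suc s) xs
      ≈⟨ *-cong (marked-other x 1+s≢i)
                (weightWith-marked i (suc s) d xs d<m (≡.trans i≡s+2+d (ℕₚ.+-suc s (suc d)))) ⟩
    factor (suc s) x * (nat (mult xs (suc d)) * weightWith factor (suc s) xs)
      ≈⟨ solve 3 (λ p q w → p :* (q :* w) := q :* (p :* w)) refl _ _ _ ⟩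
    nat (mult xs (suc d)) * weightWith factor s (x ∷ xs) ∎
    where
    1+s≢i : suc s ≢ i
    1+s≢i 1+s≡i = ℕₚ.m≢1+m+n s (≡.trans (ℕₚ.suc-injective (≡.trans 1+s≡i (≡.trans i≡s+2+d (ℕₚ.+-suc s (suc d)))))
                                         (ℕₚ.+-suc s d))

  F≈partSum-marked : ∀ d n → d < n → F (suc d) n ≈ partSum n (range 0 n) (marked (suc d)) n
  F≈partSum-marked d n d<n = begin
    F (suc d) n
      ≈⟨ F≈sum-mult (suc d) n ⟩
    sumL (map (λ r → nat (mult r (suc d)) * weightTerm r) (partitions n))
      ≈⟨ sumL-map-cong (partitions n) (λ r → trans (*-cong refl (reflexive (weightTerm′≡weightWith 0 r)))
                                                   (sym (weightWith-marked (suc d) 0 d r d<n ≡.refl))) ⟩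
    sumL (map (weightWith (marked (suc d)) 0) (partitions n))
      ≈⟨ sumL-box≈partSum n n 0 n (marked (suc d)) ⟩
    partSum n (range 0 n) (marked (suc d)) n ∎

  module AroundPart (d n : ℕ) (d<n : d < n) where
    i : ℕ
    i = suc d

    others : List ℕ
    others = range 0 d ++ range i (n ∸ i)

    others-≢ : All (_≢ i) others
    others-≢ = Allₚ.++⁺ (All-range _ 0 d (λ k _ k≤d k≡i → ℕₚ.1+n≰n (≡.subst (_≤ d) k≡i k≤d)))
                        (All-range _ i (n ∸ i) (λ k i<k _ k≡i → ℕₚ.<-irrefl (≡.sym k≡i) i<k))

    i-first : ∀ f m → partSum n (range 0 n) f m ≈ partSum n (i ∷ others) f m
    i-first f m = trans (reflexive (≡.cong (λ ks → partSum n ks f m) range-split))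
                        (partSum-front n (range 0 d) i (range i (n ∸ i)) f m)
      where
      range-split : range 0 n ≡ range 0 d ++ i ∷ range i (n ∸ i)
      range-split = ≡.trans (≡.cong (range 0) (≡.sym (≡.trans (ℕₚ.+-suc d (n ∸ i)) (ℕₚ.m+[n∸m]≡n d<n))))
                            (range-+ 0 d (suc (n ∸ i)))

  F≈Σ-a*P : ∀ n i → 1 ≤ i → i ≤ n → F i n ≈ sumFrom1 n (λ j → a i j * P (n ∸ j))
  F≈Σ-a*P n (suc d) _ d<n = sym (begin
    sumFrom1 n (λ j → a i j * P (n ∸ j))
      ≈⟨ sumFrom1-a i n (λ j → P (n ∸ j)) n ℕₚ.≤-refl ⟩
    Σ< n (λ t → ⟦ i ℕ.* suc t ≤? n ⟧ (α t * P (n ∸ i ℕ.* suc t)))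
      ≈⟨ Σ<-cong n (λ t → ⟦⟧-congʳ (i ℕ.* suc t ≤? n) (*-cong refl
           (trans (P≈partSum-range (ℕₚ.m∸n≤m n (i ℕ.* suc t))) (i-first factor _)))) ⟩
    Σ< n (λ t → ⟦ i ℕ.* suc t ≤? n ⟧ (α t * partSum n (i ∷ others) factor (n ∸ i ℕ.* suc t)))
      ≈⟨ Σ<-cauchy i n α (factor i) H (s≤s z≤n) ⟩
    Σ< (suc n) (λ x → ⟦ i ℕ.* x ≤? n ⟧ (Σ< x (λ t → α t * factor i (x ∸ suc t)) * H (n ∸ i ℕ.* x)))
      ≈⟨ Σ<-cong (suc n) (λ x → ⟦⟧-congʳ (i ℕ.* x ≤? n) (*-cong (sym (nat*factor i x)) refl)) ⟩
    Σ< (suc n) (λ x → ⟦ i ℕ.* x ≤? n ⟧ (nat x * factor i x * H (n ∸ i ℕ.* x)))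
      ≈⟨ sym (Σ<-cong (suc n) (λ x → ⟦⟧-congʳ (i ℕ.* x ≤? n)
                (*-cong (marked-self i x) (partSum-cong n others (marked i) factor unmarked-others _)))) ⟩
    partSum n (i ∷ others) (marked i) n  ≈⟨ sym (i-first (marked i) n) ⟩
    partSum n (range 0 n) (marked i) n   ≈⟨ sym (F≈partSum-marked d n d<n) ⟩
    F i n                                ∎)
    where
    open AroundPart d n d<n
    α = λ t → b i * pow z (suc t)
    H = partSum n others factor
    unmarked-others : All (λ k → ∀ x → marked i k x ≈ factor k x) others
    unmarked-others = All.map (λ k≢i x → marked-other x k≢i) others-≢

theorem2p3 : ∀ {c ℓ : Level} (R : CommutativeRing c ℓ)
    (inv : ℕ → CommutativeRing.Carrier R) →
    (∀ n → CommutativeRing._≈_ R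
             (CommutativeRing._*_ R (natR R (suc n)) (inv (suc n)))
             (CommutativeRing.1# R)) →
    (z : CommutativeRing.Carrier R) (b : ℕ → CommutativeRing.Carrier R) →
    let open CommutativeRing R
        open Setup R inv z b
    in (P 0 ≈ 1#)
       × (∀ n i → 1 ≤ n → 1 ≤ i → i ≤ n →
            F i n ≈ sumFrom1 n (λ j → a i j * P (n ∸ j)))
       × (∀ n → 1 ≤ n →
            sumFrom1 n (λ k → k · F k n) ≈ n · P n)
theorem2p3 R inv inv-inverse z b =
  P0≈1 , (λ n i _ → F≈Σ-a*P n i) , (λ n _ → Σ-kF≈nP n)
  where open Theorem R inv inv-inverse z b
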